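{- Let $k \ge 3$ and let $\Phi$ be an E3-SAT formula with $m$ clauses and $n$ variables; let $G_\Phi$, $I_s$, $I_t$ be as in the context. If there exists a reconfiguration sequence from $I_s$ to $I_t$ in $G_\Phi$ under the $k$-Jump model of length at most $2(m+n)$, then $\Phi$ is satisfiable.
   Context: Fix an integer $k \ge 3$. An E3-SAT formula is a CNF formula in which every clause has exactly three literals. Let $\Phi$ have clauses $c_0, \dots, c_{m-1}$ and variables $x_0, \dots, x_{n-1}$. The graph $G_\Phi$: for each clause $c_i$, a path $v^i_0 v^i_1 \cdots v^i_{2k}$, with $k^i_1 = v^i_k$, plus vertices $k^i_0, k^i_2$ each adjacent to $v^i_{k-1}$ and $v^i_{k+1}$; for each variable $x_j$, a path $u^j_0 \cdots u^j_{k-1}$ with $t^j_0 = u^j_0$, $t^j_1 = u^j_{k-1}$, plus vertices $s^j_0, s^j_1$ each adjacent to $t^j_0$; the set $K = \{k^i_0, k^i_1, k^i_2 : 0 \le i < m\}$ is a clique; for each clause $c_i = (\ell_0 \vee \ell_1 \vee \ell_2)$ and $r \in \{0,1,2\}$, with $x_j$ the variable of $\ell_r$, add edges $\{s^j_0, k^i_r\}, \{t^j_0, k^i_r\}$ if $\ell_r$ is positive and $\{s^j_1, k^i_r\}, \{t^j_0, k^i_r\}$ if $\ell_r$ is negative; no other edges. $I_s = \{v^i_0 : 0 \le i < m\} \cup \{s^j_0, s^j_1 : 0 \le j < n\}$ and $I_t = \{v^i_{2k} : 0 \le i < m\} \cup \{t^j_0, t^j_1 : 0 \le j < n\}$. For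 independent sets $I, J$, write $I \leftrightarrow_k J$ if $|I \setminus J| = |J \setminus I| = 1$ and $\mathrm{dist}_{G_\Phi}(u,v) \le k$ where $I \setminus J = \{u\}$, $J \setminus I = \{v\}$. A reconfiguration sequence of length $\ell$ from $I_s$ to $I_t$ is a sequence $I_s = I_0, \dots, I_\ell = I_t$ of independent sets with $I_j \leftrightarrow_k I_{j+1}$ for all $j$. -}

module Defs where

open import Data.Nat using (ℕ; zero; suc; _+_; _*_; _∸_; _≤_; _≡ᵇ_)
open import Data.Fin using (Fin; toℕ)
open import Data.Bool using (Bool; true; false; _∨_; if_then_else_)
open import Data.Product using (_×_; _,_; Σ; ∃; ∃-syntax)
open import Data.Sum using (_⊎_)
open import Relation.Binary.PropositionalEquality using (_≡_; _≢_)
open import Relation.Nullary using (¬_)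

-- A literal: a variable index together with its polarity (true = positive).
Literal : ℕ → Set
Literal n = Fin n × Bool

Formula : ℕ → ℕ → Set
Formula m n = Fin m → Fin 3 → Literal n

litVal : ∀ {n} → (Fin n → Bool) → Literal n → Bool
litVal a (x , true)  = a x
litVal a (x , false) = if a x then false else true

Satisfiable : ∀ {m n} → Formula m n → Set
Satisfiable {m} {n} Φ =
  ∃[ a ] ((i : Fin m) → ∃[ r ] (litVal {n} a (Φ i r) ≡ true))

module Construction (k m n : ℕ) (Φ : Formula m n) where

  data Vertex : Set where
    -- v i p = v^i_p, 0 ≤ p ≤ 2k   (k^i_1 = v^i_k)
    v   : Fin m → Fin (suc (k + k)) → Vertex
    kc0 : Fin m → Vertex
    kc2 : Fin m → Vertex
    -- u j p = u^j_p, 0 ≤ p ≤ k-1   (t^j_0 = u^j_0, t^j_1 = u^j_{k-1})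
    u   : Fin n → Fin k → Vertex
    s   : Fin n → Fin 2 → Vertex

  data InK : Vertex → Set where
    inK0 : ∀ i → InK (kc0 i)
    inK1 : ∀ i p → toℕ p ≡ k → InK (v i p)
    inK2 : ∀ i → InK (kc2 i)

  data IsKr : Fin m → Fin 3 → Vertex → Set where
    isK0 : ∀ i → IsKr i Fin.zero (kc0 i)
    isK1 : ∀ i p → toℕ p ≡ k → IsKr i (Fin.suc Fin.zero) (v i p)
    isK2 : ∀ i → IsKr i (Fin.suc (Fin.suc Fin.zero)) (kc2 i)

  sIdx : Bool → Fin 2
  sIdx true  = Fin.zero
  sIdx false = Fin.suc Fin.zero

  data Edge : Vertex → Vertex → Set where
    vpath  : ∀ i p q → toℕ q ≡ suc (toℕ p) → Edge (v i p) (v i q)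
    k0-adj : ∀ i p → (toℕ p ≡ k ∸ 1) ⊎ (toℕ p ≡ k + 1) → Edge (kc0 i) (v i p)
    k2-adj : ∀ i p → (toℕ p ≡ k ∸ 1) ⊎ (toℕ p ≡ k + 1) → Edge (kc2 i) (v i p)
    upath  : ∀ j p q → toℕ q ≡ suc (toℕ p) → Edge (u j p) (u j q)
    s-t0   : ∀ j b p → toℕ p ≡ 0 → Edge (s j b) (u j p)
    clique : ∀ x y → InK x → InK y → x ≢ y → Edge x y
    lit-s  : ∀ i r x → IsKr i r x →
             Edge (s (Data.Product.proj₁ (Φ i r)) (sIdx (Data.Product.proj₂ (Φ i r)))) x
    lit-t  : ∀ i r x p → IsKr i r x → toℕ p ≡ 0 →
             Edge (u (Data.Product.proj₁ (Φ i r)) p) x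

  Adj : Vertex → Vertex → Set
  Adj x y = Edge x y ⊎ Edge y x

  -- DistLe d x y  ⇔  dist_{G_Φ}(x , y) ≤ d
  data DistLe : ℕ → Vertex → Vertex → Set where
    here : ∀ {d x} → DistLe d x x
    step : ∀ {d x y z} → Adj x y → DistLe d y z → DistLe (suc d) x z

  VSet : Set
  VSet = Vertex → Bool

  _≈_ : VSet → VSet → Set
  I ≈ J = ∀ x → I x ≡ J x

  Independent : VSet → Set
  Independent I = ∀ x y → I x ≡ true → I y ≡ true → ¬ Adj x y

  Jump : VSet → VSet → Set
  Jump I J = Σ Vertex λ a → Σ Vertex λ b →
      (I a ≡ true) × (J a ≡ false) × (J b ≡ true) × (I b ≡ false)
    × (∀ x → x ≢ a → x ≢ b → I x ≡ J x)
    × DistLe k a b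

  data ReconfSeq : ℕ → VSet → VSet → Set where
    done : ∀ {I J} → Independent I → I ≈ J → ReconfSeq 0 I J
    next : ∀ {ℓ I I' J} → Independent I → Jump I I' → ReconfSeq ℓ I' J →
           ReconfSeq (suc ℓ) I J

  Is : VSet
  Is (v i p) = toℕ p ≡ᵇ 0
  Is (s j b) = true
  Is _       = false

  It : VSet
  It (v i p) = toℕ p ≡ᵇ (k + k)
  It (u j p) = (toℕ p ≡ᵇ 0) ∨ (toℕ p ≡ᵇ (k ∸ 1))
  It _       = false

{-# OPTIONS --safe #-}
-- A potential argument. Charge one unit for every vertex of I_t that is still empty, and one
-- for every clause whose token has not yet left v^i_0 for the upper half of its gadget
-- (k^i_0, k^i_2 or v^i_p with p ≥ k). This potential is 2(m + n) at I_s, 0 at I_t, and a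
-- k-jump lowers it by at most one, so along a sequence of length at most 2(m + n) every jump
-- lowers it by exactly one. A jump out of a canonical configuration either does not lower the
-- potential or leads to a canonical configuration, in which each clause token sits on v^i_0,
-- on one k^i_r or on v^i_{2k}, and the two tokens of x_j have moved, in this order,
-- from s^j_{sIdx σ} to t^j_1 (fixing x_j = σ) and from the other s-vertex to t^j_0. A clause
-- token can enter k^i_r only when the s- and t_0-neighbours of k^i_r are empty, i.e. when
-- literal r is already fixed true. At I_t every clause token has left v^i_0, so the fixed
-- values satisfy Φ. The distance facts come from 1-Lipschitz functions vanishing at v^i_0,
-- v^i_{2k} and t^j_1.
module Submission where

open import Defs
open import Data.Nat
  using (ℕ; zero; suc; _+_; _*_; _∸_; _≤_; _<_; z≤n; s≤s; _≤?_; NonZero; pred; ≢-nonZero⁻¹)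
open import Data.Nat.Properties
open import Data.Fin using (Fin; toℕ; fromℕ; fromℕ<)
import Data.Fin as Fin
import Data.Fin.Properties as Finₚ
open import Data.Bool using (Bool; true; false; not; _∨_)
import Data.Bool.Properties as Boolₚ
open import Data.Product using (Σ; ∃-syntax; _×_; _,_; proj₁; proj₂; swap)
import Data.Product.Properties as Productₚ
open import Data.Sum using (_⊎_; inj₁; inj₂; [_,_]′)
import Data.Sum.Properties as Sumₚ
open import Data.Vec.Functional using (updateAt)
open import Data.Vec.Functional.Properties using (updateAt-updates; updateAt-minimal)
open import Function using (_∘_; const)
open import Relation.Nullary using (¬_; Dec; yes; no; does; contradiction)
open import Relation.Nullary.Decidable using (map′; dec-true; dec-false; _×-dec_; _⊎-dec_)
open import Relation.Binary.Definitions using (DecidableEquality)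
open import Relation.Binary.PropositionalEquality

∣_-_∣≤_ : ℕ → ℕ → ℕ → Set
∣ x - y ∣≤ d = x ≤ d + y × y ≤ d + x

∣suc[x]-x∣≤1 : ∀ x → ∣ suc x - x ∣≤ 1
∣suc[x]-x∣≤1 x = ≤-refl , ≤-trans (n≤1+n x) (n≤1+n (suc x))

∣m∸n-m∸[1+n]∣≤1 : ∀ m n → ∣ m ∸ n - m ∸ suc n ∣≤ 1
∣m∸n-m∸[1+n]∣≤1 m n = subst (∣ m ∸ n -_∣≤ 1) (pred[m∸n]≡m∸[1+n] m n) (∣x-pred[x]∣≤1 (m ∸ n))
  where
  ∣x-pred[x]∣≤1 : ∀ x → ∣ x - pred x ∣≤ 1
  ∣x-pred[x]∣≤1 zero    = z≤n , z≤n
  ∣x-pred[x]∣≤1 (suc x) = ∣suc[x]-x∣≤1 x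

dec-true⁻¹ : ∀ {a} {A : Set a} (A? : Dec A) → does A? ≡ true → A
dec-true⁻¹ (yes a) _ = a

penalty : ∀ {p} {P : Set p} → Dec P → ℕ
penalty (yes _) = 0
penalty (no _)  = 1

penalty-yes : ∀ {p} {P : Set p} (P? : Dec P) → P → penalty P? ≡ 0
penalty-yes (yes _) _ = refl
penalty-yes (no ¬p) p = contradiction p ¬p

penalty-no : ∀ {p} {P : Set p} (P? : Dec P) → ¬ P → penalty P? ≡ 1
penalty-no (yes p) ¬p = contradiction p ¬p
penalty-no (no _)  _  = refl

penalty-≤1 : ∀ {p} {P : Set p} (P? : Dec P) → penalty P? ≤ 1
penalty-≤1 (yes _) = z≤n
penalty-≤1 (no _)  = ≤-refl

penalty-anti : ∀ {p q} {P : Set p} {Q : Set q} (P? : Dec P) (Q? : Dec Q) →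
               (Q → P) → penalty P? ≤ penalty Q?
penalty-anti (yes _)  _       _   = z≤n
penalty-anti (no ¬p) (yes q)  Q⇒P = contradiction (Q⇒P q) ¬p
penalty-anti (no _)  (no _)   _   = ≤-refl

sum : ∀ {N} → (Fin N → ℕ) → ℕ
sum {zero}  f = 0
sum {suc N} f = f Fin.zero + sum (f ∘ Fin.suc)

sum-mono-≤ : ∀ {N} {f g : Fin N → ℕ} → (∀ i → f i ≤ g i) → sum f ≤ sum g
sum-mono-≤ {zero}  f≤g = z≤n
sum-mono-≤ {suc N} f≤g = +-mono-≤ (f≤g Fin.zero) (sum-mono-≤ (f≤g ∘ Fin.suc))

sum-≤-suc : ∀ {N} {f g : Fin N → ℕ} (i : Fin N) → (∀ j → j ≢ i → f j ≤ g j) →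
            f i ≤ suc (g i) → sum f ≤ suc (sum g)
sum-≤-suc Fin.zero f≤g fi≤ = +-mono-≤ fi≤ (sum-mono-≤ (λ j → f≤g (Fin.suc j) (λ ())))
sum-≤-suc {f = f} {g} (Fin.suc i) f≤g fi≤ = begin
  f Fin.zero + sum (f ∘ Fin.suc)        ≤⟨ +-mono-≤ (f≤g Fin.zero (λ ())) (sum-≤-suc i f≤g∘suc fi≤) ⟩
  g Fin.zero + suc (sum (g ∘ Fin.suc))  ≡⟨ +-suc (g Fin.zero) _ ⟩
  suc (sum g)                           ∎
  where
  open ≤-Reasoning
  f≤g∘suc : ∀ j → j ≢ i → f (Fin.suc j) ≤ g (Fin.suc j)
  f≤g∘suc j j≢i = f≤g (Fin.suc j) (j≢i ∘ Finₚ.suc-injective)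

sum-mono-< : ∀ {N} {f g : Fin N → ℕ} (i : Fin N) → (∀ j → f j ≤ g j) →
             f i < g i → sum f < sum g
sum-mono-< Fin.zero f≤g fi<gi = +-mono-≤ fi<gi (sum-mono-≤ (f≤g ∘ Fin.suc))
sum-mono-< {f = f} (Fin.suc i) f≤g fi<gi =
  ≤-trans (≤-reflexive (sym (+-suc (f Fin.zero) _)))
          (+-mono-≤ (f≤g Fin.zero) (sum-mono-< i (f≤g ∘ Fin.suc) fi<gi))

sum-const : ∀ {N c} {f : Fin N → ℕ} → (∀ i → f i ≡ c) → sum f ≡ N * c
sum-const {zero}      f≡c = refl
sum-const {suc N} {c} f≡c = cong₂ _+_ (f≡c Fin.zero) (sum-const (f≡c ∘ Fin.suc))

module Graph (k m n : ℕ) (Φ : Formula m n) where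
  open Construction k m n Φ public

  owner : Vertex → Fin m ⊎ Fin n
  owner (v i _)   = inj₁ i
  owner (kc0 i)   = inj₁ i
  owner (kc2 i)   = inj₁ i
  owner (u j _)   = inj₂ j
  owner (s j _)   = inj₂ j

  private
    Code : Set
    Code = (Fin m × Fin (suc (k + k))) ⊎ (Fin m ⊎ (Fin m ⊎ ((Fin n × Fin k) ⊎ (Fin n × Fin 2))))

    encode : Vertex → Code
    encode (v i p) = inj₁ (i , p)
    encode (kc0 i) = inj₂ (inj₁ i)
    encode (kc2 i) = inj₂ (inj₂ (inj₁ i))
    encode (u j p) = inj₂ (inj₂ (inj₂ (inj₁ (j , p))))
    encode (s j c) = inj₂ (inj₂ (inj₂ (inj₂ (j , c))))

    decode : Code → Vertex
    decode (inj₁ (i , p))                      = v i p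
    decode (inj₂ (inj₁ i))                     = kc0 i
    decode (inj₂ (inj₂ (inj₁ i)))              = kc2 i
    decode (inj₂ (inj₂ (inj₂ (inj₁ (j , p))))) = u j p
    decode (inj₂ (inj₂ (inj₂ (inj₂ (j , c))))) = s j c

    decode-encode : ∀ x → decode (encode x) ≡ x
    decode-encode (v _ _) = refl
    decode-encode (kc0 _) = refl
    decode-encode (kc2 _) = refl
    decode-encode (u _ _) = refl
    decode-encode (s _ _) = refl

    encode-injective : ∀ {x y} → encode x ≡ encode y → x ≡ y
    encode-injective {x} {y} eq =
      trans (sym (decode-encode x)) (trans (cong decode eq) (decode-encode y))

    _≟ᶜ_ : DecidableEquality Code
    _≟ᶜ_ = Sumₚ.≡-dec (Productₚ.≡-dec Finₚ._≟_ Finₚ._≟_)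
           (Sumₚ.≡-dec Finₚ._≟_ (Sumₚ.≡-dec Finₚ._≟_
             (Sumₚ.≡-dec (Productₚ.≡-dec Finₚ._≟_ Finₚ._≟_) (Productₚ.≡-dec Finₚ._≟_ Finₚ._≟_))))

  -- Opaque, so that  does (x ≟ᵛ y)  stays a neutral term during unification.
  opaque
    _≟ᵛ_ : DecidableEquality Vertex
    x ≟ᵛ y = map′ encode-injective (cong encode) (encode x ≟ᶜ encode y)

  IsKr⇒InK : ∀ {i r x} → IsKr i r x → InK x
  IsKr⇒InK (isK0 i)     = inK0 i
  IsKr⇒InK (isK1 i p e) = inK1 i p e
  IsKr⇒InK (isK2 i)     = inK2 i

  Lipschitz : (Vertex → ℕ) → Set
  Lipschitz h = ∀ {x y} → Edge x y → ∣ h x - h y ∣≤ 1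

  lipschitz-dist : ∀ {h} → Lipschitz h → ∀ {d x z} → DistLe d x z → ∣ h x - h z ∣≤ d
  lipschitz-dist {h} L {d} {x} here = m≤n+m (h x) d , m≤n+m (h x) d
  lipschitz-dist {h} L {suc d} {x} {z} (step {y = y} adj r) =
    ≤-trans hx≤ (s≤s (proj₁ (lipschitz-dist L r))) ,
    ≤-trans (proj₂ (lipschitz-dist L r)) (≤-trans (+-monoʳ-≤ d hy≤) (≤-reflexive (+-suc d (h x))))
    where
    hx≤ : h x ≤ suc (h y)
    hx≤ = [ proj₁ ∘ L , proj₂ ∘ L ]′ adj
    hy≤ : h y ≤ suc (h x)
    hy≤ = [ proj₂ ∘ L , proj₁ ∘ L ]′ adj

  occupied≢vacant : ∀ {I : VSet} {x y} → I x ≡ true → I y ≡ false → x ≢ y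
  occupied≢vacant Ix Iy refl = contradiction (trans (sym Ix) Iy) λ ()

  record Move (I J : VSet) (a b : Vertex) : Set where
    field
      vacates   : J a ≡ false
      fills     : J b ≡ true
      elsewhere : ∀ x → x ≢ a → x ≢ b → I x ≡ J x

  module _ {I J a b} (M : Move I J a b) where
    open Move M

    move-preserves : ∀ {x} → x ≢ a → I x ≡ true → J x ≡ true
    move-preserves {x} x≢a Ix with x ≟ᵛ b
    ... | yes refl = fills
    ... | no x≢b   = trans (sym (elsewhere x x≢a x≢b)) Ix

    move-reflects : I a ≡ true → ∀ {x} → x ≢ b → J x ≡ true → I x ≡ true
    move-reflects Ia {x} x≢b Jx with x ≟ᵛ a
    ... | yes refl = Ia
    ... | no x≢a   = trans (elsewhere x x≢a x≢b) Jx

    move-vacated : ∀ {x} → I x ≡ true → J x ≡ false → x ≡ a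
    move-vacated {x} Ix Jx with x ≟ᵛ a
    ... | yes x≡a = x≡a
    ... | no x≢a  = contradiction (trans (sym Jx) (move-preserves x≢a Ix)) λ ()

    move-unique : ∀ {O O'} → I ≈ O → Move O O' a b → J ≈ O'
    move-unique I≈O M' x with x ≟ᵛ a | x ≟ᵛ b
    ... | yes refl | _        = trans vacates (sym (Move.vacates M'))
    ... | no _     | yes refl = trans fills (sym (Move.fills M'))
    ... | no x≢a   | no x≢b   =
      trans (sym (elsewhere x x≢a x≢b)) (trans (I≈O x) (Move.elsewhere M' x x≢a x≢b))

module Reduction (K : ℕ) .{{_ : NonZero K}} {m n : ℕ} (Φ : Formula m n) where

  k : ℕ
  k = suc K

  open Graph k m n Φ

  mid end : Fin (suc (k + k))
  mid = fromℕ< (s≤s (m≤m+n k k))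
  end = fromℕ (k + k)

  bottom middle top : Fin m → Vertex
  bottom i = v i Fin.zero
  middle i = v i mid
  top    i = v i end

  t₀ t₁ : Fin n → Vertex
  t₀ j = u j Fin.zero
  t₁ j = u j (fromℕ K)

  toℕ-mid : toℕ mid ≡ k
  toℕ-mid = Finₚ.toℕ-fromℕ< (s≤s (m≤m+n k k))

  toℕ-end : toℕ end ≡ k + k
  toℕ-end = Finₚ.toℕ-fromℕ (k + k)

  [k+k]∸k≡k : (k + k) ∸ k ≡ k
  [k+k]∸k≡k = m+n∸n≡m k k

  [k+k]∸n≤k⇒k≤n : ∀ p → (k + k) ∸ p ≤ k → k ≤ p
  [k+k]∸n≤k⇒k≤n p le = +-cancelʳ-≤ k k p (≤-trans (m≤n+m∸n (k + k) p) (+-monoʳ-≤ p le))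

  KLevel : ℕ → Set
  KLevel x = x ≡ k ⊎ x ≡ suc k

  KLevel-close : ∀ {x y} → KLevel x → KLevel y → ∣ x - y ∣≤ 1
  KLevel-close (inj₁ refl) (inj₁ refl) = n≤1+n k , n≤1+n k
  KLevel-close (inj₁ refl) (inj₂ refl) = ≤-trans (n≤1+n k) (n≤1+n (suc k)) , ≤-refl
  KLevel-close (inj₂ refl) (inj₁ refl) = ≤-refl , ≤-trans (n≤1+n k) (n≤1+n (suc k))
  KLevel-close (inj₂ refl) (inj₂ refl) = n≤1+n (suc k) , n≤1+n (suc k)

  local : ∀ {N} → Fin N → Fin N → ℕ → ℕ
  local i i' x with i' Fin.≟ i
  ... | yes _ = x
  ... | no _  = suc k

  local-same : ∀ {N} (i : Fin N) x → local i i x ≡ x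
  local-same i x with i Fin.≟ i
  ... | yes _  = refl
  ... | no i≢i = contradiction refl i≢i

  local≤k⇒same : ∀ {N} (i i' : Fin N) {x} → local i i' x ≤ k → i' ≡ i
  local≤k⇒same i i' le with i' Fin.≟ i
  ... | yes i'≡i = i'≡i
  ... | no _     = contradiction le (1+n≰n)

  local-close : ∀ {N} (i i' : Fin N) {x y} → ∣ x - y ∣≤ 1 → ∣ local i i' x - local i i' y ∣≤ 1
  local-close i i' close with i' Fin.≟ i
  ... | yes _ = close
  ... | no _  = KLevel-close (inj₂ refl) (inj₂ refl)

  local-KLevel : ∀ {N} (i i' : Fin N) {x} → KLevel x → KLevel (local i i' x)
  local-KLevel i i' lvl with i' Fin.≟ i
  ... | yes _ = lvl
  ... | no _  = inj₂ refl

  local-close-k : ∀ {N} (i i' : Fin N) {x} → ∣ x - k ∣≤ 1 → ∣ local i i' x - k ∣≤ 1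
  local-close-k i i' close with i' Fin.≟ i
  ... | yes _ = close
  ... | no _  = ∣suc[x]-x∣≤1 k

  -- pos p is the distance from v^i_p to the end of the clause path where pos vanishes; capped
  -- at k + 1 outside clause i, it gives a 1-Lipschitz lower bound dEnd i on the distance to that end.
  module ClauseEnd (pos : ℕ → ℕ)
                   (pos-step : ∀ p → ∣ pos p - pos (suc p) ∣≤ 1)
                   (pos-K : ∣ k - pos K ∣≤ 1)
                   (pos-k+1 : ∣ k - pos (k + 1) ∣≤ 1)
                   (pos-k : pos k ≡ k) where

    dEnd : Fin m → Vertex → ℕ
    dEnd i (v i' p) = local i i' (pos (toℕ p))
    dEnd i (kc0 i') = local i i' k
    dEnd i (kc2 i') = local i i' k
    dEnd i (u _ _)  = suc k
    dEnd i (s _ _)  = suc k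

    dEnd-KLevel : ∀ i {x} → InK x → KLevel (dEnd i x)
    dEnd-KLevel i (inK0 i')     = local-KLevel i i' (inj₁ refl)
    dEnd-KLevel i (inK1 i' p e) = local-KLevel i i' (inj₁ (trans (cong pos e) pos-k))
    dEnd-KLevel i (inK2 i')     = local-KLevel i i' (inj₁ refl)

    beside-k : ∀ {p} → (p ≡ k ∸ 1) ⊎ (p ≡ k + 1) → ∣ k - pos p ∣≤ 1
    beside-k (inj₁ refl) = pos-K
    beside-k (inj₂ refl) = pos-k+1

    dEnd-lipschitz : ∀ i → Lipschitz (dEnd i)
    dEnd-lipschitz i (vpath i' p q e)   =
      local-close i i' (subst (λ t → ∣ pos (toℕ p) - pos t ∣≤ 1) (sym e) (pos-step (toℕ p)))
    dEnd-lipschitz i (k0-adj i' p side) = local-close i i' (beside-k side)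
    dEnd-lipschitz i (k2-adj i' p side) = local-close i i' (beside-k side)
    dEnd-lipschitz i (upath _ _ _ _)    = KLevel-close (inj₂ refl) (inj₂ refl)
    dEnd-lipschitz i (s-t0 _ _ _ _)     = KLevel-close (inj₂ refl) (inj₂ refl)
    dEnd-lipschitz i (clique _ _ x∈K y∈K _) = KLevel-close (dEnd-KLevel i x∈K) (dEnd-KLevel i y∈K)
    dEnd-lipschitz i (lit-s _ _ _ isK)     = KLevel-close (inj₂ refl) (dEnd-KLevel i (IsKr⇒InK isK))
    dEnd-lipschitz i (lit-t _ _ _ _ isK _) = KLevel-close (inj₂ refl) (dEnd-KLevel i (IsKr⇒InK isK))

    data Near (i : Fin m) : Vertex → Set where
      near-kc0 : Near i (kc0 i)
      near-kc2 : Near i (kc2 i)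
      near-v   : ∀ {p} → pos (toℕ p) ≤ k → Near i (v i p)

    dEnd≤k⇒Near : ∀ {i} x → dEnd i x ≤ k → Near i x
    dEnd≤k⇒Near {i} (v i' p) le with refl ← local≤k⇒same i i' le = near-v (subst (_≤ k) (local-same i _) le)
    dEnd≤k⇒Near {i} (kc0 i') le with refl ← local≤k⇒same i i' le = near-kc0
    dEnd≤k⇒Near {i} (kc2 i') le with refl ← local≤k⇒same i i' le = near-kc2
    dEnd≤k⇒Near (u _ _) le = contradiction le 1+n≰n
    dEnd≤k⇒Near (s _ _) le = contradiction le 1+n≰n

    Near-of-dist : ∀ {i p x} → pos (toℕ p) ≡ 0 →
                   DistLe k x (v i p) ⊎ DistLe k (v i p) x → Near i x
    Near-of-dist {i} {p} {x} end≡0 d = dEnd≤k⇒Near x (begin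
      dEnd i x          ≤⟨ bound d ⟩
      k + dEnd i (v i p) ≡⟨ cong (k +_) (trans (local-same i _) end≡0) ⟩
      k + 0             ≡⟨ +-identityʳ k ⟩
      k                 ∎)
      where
      open ≤-Reasoning
      bound : DistLe k x (v i p) ⊎ DistLe k (v i p) x → dEnd i x ≤ k + dEnd i (v i p)
      bound (inj₁ d) = proj₁ (lipschitz-dist (dEnd-lipschitz i) d)
      bound (inj₂ d) = proj₂ (lipschitz-dist (dEnd-lipschitz i) d)

  ∣K-k∣≤1 : ∣ K - k ∣≤ 1
  ∣K-k∣≤1 = swap (∣suc[x]-x∣≤1 K)

  [k+k]∸K≡suc[k] : (k + k) ∸ K ≡ suc k
  [k+k]∸K≡suc[k] = trans (cong (_∸ K) (sym (+-suc K k))) (m+n∸m≡n K (suc k))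

  [k+k]∸[k+1]≡K : (k + k) ∸ (k + 1) ≡ K
  [k+k]∸[k+1]≡K = trans (sym (∸-+-assoc (k + k) k 1)) (cong (_∸ 1) (m+n∸n≡m k k))

  module TopEnd = ClauseEnd ((k + k) ∸_) (∣m∸n-m∸[1+n]∣≤1 (k + k))
    (KLevel-close (inj₁ refl) (inj₂ [k+k]∸K≡suc[k]))
    (subst (∣ k -_∣≤ 1) (sym [k+k]∸[k+1]≡K) (swap ∣K-k∣≤1))
    [k+k]∸k≡k

  module BottomEnd = ClauseEnd (λ p → p) (λ p → swap (∣suc[x]-x∣≤1 p)) (∣suc[x]-x∣≤1 K)
    (subst (∣ k -_∣≤ 1) (+-comm 1 k) (swap (∣suc[x]-x∣≤1 k)))
    refl

  open TopEnd using ()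
    renaming (Near to NearTop; near-kc0 to upper-kc0; near-kc2 to upper-kc2; near-v to upper-v)
  open BottomEnd using ()
    renaming (Near to NearBottom; near-kc0 to lower-kc0; near-kc2 to lower-kc2; near-v to lower-v)

  NearTop-of-dist : ∀ {i x} → DistLe k x (top i) → NearTop i x
  NearTop-of-dist d =
    TopEnd.Near-of-dist (trans (cong ((k + k) ∸_) toℕ-end) (n∸n≡0 (k + k))) (inj₁ d)

  NearBottom-of-dist : ∀ {i x} → DistLe k (bottom i) x → NearBottom i x
  NearBottom-of-dist d = BottomEnd.Near-of-dist refl (inj₂ d)

  dT₁ : Fin n → Vertex → ℕ
  dT₁ j (v i q) with toℕ q ≟ k
  ... | yes _ = k
  ... | no _  = suc k
  dT₁ j (kc0 _)  = k
  dT₁ j (kc2 _)  = k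
  dT₁ j (u j' q) = local j j' (K ∸ toℕ q)
  dT₁ j (s j' c) = local j j' k

  dT₁-v-KLevel : ∀ j i q → KLevel (dT₁ j (v i q))
  dT₁-v-KLevel j i q with toℕ q ≟ k
  ... | yes _ = inj₁ refl
  ... | no _  = inj₂ refl

  dT₁-K : ∀ j {x} → InK x → dT₁ j x ≡ k
  dT₁-K j (inK0 i)     = refl
  dT₁-K j (inK2 i)     = refl
  dT₁-K j (inK1 i p e) with toℕ p ≟ k
  ... | yes _  = refl
  ... | no p≢k = contradiction e p≢k

  dT₁-lipschitz : ∀ j → Lipschitz (dT₁ j)
  dT₁-lipschitz j (vpath i p q _)      = KLevel-close (dT₁-v-KLevel j i p) (dT₁-v-KLevel j i q)
  dT₁-lipschitz j (k0-adj i p _)       = KLevel-close (inj₁ refl) (dT₁-v-KLevel j i p)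
  dT₁-lipschitz j (k2-adj i p _)       = KLevel-close (inj₁ refl) (dT₁-v-KLevel j i p)
  dT₁-lipschitz j (upath j' p q e)     =
    local-close j j' (subst (λ t → ∣ K ∸ toℕ p - K ∸ t ∣≤ 1) (sym e) (∣m∸n-m∸[1+n]∣≤1 K (toℕ p)))
  dT₁-lipschitz j (s-t0 j' _ p e)      =
    local-close j j' (subst (λ t → ∣ k - K ∸ t ∣≤ 1) (sym e) (swap ∣K-k∣≤1))
  dT₁-lipschitz j (clique x y x∈K y∈K _) =
    subst₂ (λ a b → ∣ a - b ∣≤ 1) (sym (dT₁-K j x∈K)) (sym (dT₁-K j y∈K)) (KLevel-close (inj₁ refl) (inj₁ refl))
  dT₁-lipschitz j (lit-s i r x isK)    =
    subst (λ b → ∣ local j _ k - b ∣≤ 1) (sym (dT₁-K j (IsKr⇒InK isK)))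
          (KLevel-close (local-KLevel j _ (inj₁ refl)) (inj₁ refl))
  dT₁-lipschitz j (lit-t i r x p isK e) =
    subst (λ b → ∣ local j _ (K ∸ toℕ p) - b ∣≤ 1) (sym (dT₁-K j (IsKr⇒InK isK)))
          (local-close-k j _ (subst (λ t → ∣ K ∸ t - k ∣≤ 1) (sym e) ∣K-k∣≤1))

  data NearT₁ (j : Fin n) : Vertex → Set where
    near-u : ∀ {q} → NearT₁ j (u j q)
    near-s : ∀ {c} → NearT₁ j (s j c)
    near-K : ∀ {x} → InK x → NearT₁ j x

  dT₁≤k⇒NearT₁ : ∀ {j} x → dT₁ j x ≤ k → NearT₁ j x
  dT₁≤k⇒NearT₁ (v i q) le with toℕ q ≟ k
  ... | yes q≡k = near-K (inK1 i q q≡k)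
  ... | no _    = contradiction le 1+n≰n
  dT₁≤k⇒NearT₁ (kc0 i) _ = near-K (inK0 i)
  dT₁≤k⇒NearT₁ (kc2 i) _ = near-K (inK2 i)
  dT₁≤k⇒NearT₁ {j} (u j' q) le with refl ← local≤k⇒same j j' le = near-u
  dT₁≤k⇒NearT₁ {j} (s j' c) le with refl ← local≤k⇒same j j' le = near-s

  NearT₁-of-dist : ∀ {j x} → DistLe k x (t₁ j) → NearT₁ j x
  NearT₁-of-dist {j} {x} d = dT₁≤k⇒NearT₁ x (begin
    dT₁ j x          ≤⟨ proj₁ (lipschitz-dist (dT₁-lipschitz j) d) ⟩
    k + dT₁ j (t₁ j) ≡⟨ cong (k +_) t₁-value ⟩
    k + 0            ≡⟨ +-identityʳ k ⟩
    k                ∎)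
    where
    open ≤-Reasoning
    t₁-value : dT₁ j (t₁ j) ≡ 0
    t₁-value = trans (local-same j _) (trans (cong (K ∸_) (Finₚ.toℕ-fromℕ K)) (n∸n≡0 K))

  NearTop-owner : ∀ {i x} → NearTop i x → owner x ≡ inj₁ i
  NearTop-owner upper-kc0   = refl
  NearTop-owner upper-kc2   = refl
  NearTop-owner (upper-v _) = refl

  NearBottom-owner : ∀ {i x} → NearBottom i x → owner x ≡ inj₁ i
  NearBottom-owner lower-kc0   = refl
  NearBottom-owner lower-kc2   = refl
  NearBottom-owner (lower-v _) = refl

  top∈NearTop : ∀ {i} → NearTop i (top i)
  top∈NearTop = upper-v (≤-trans (≤-reflexive (trans (cong ((k + k) ∸_) toℕ-end) (n∸n≡0 (k + k)))) z≤n)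

  bottom∉NearTop : ∀ {i x} → NearTop i x → x ≢ bottom i
  bottom∉NearTop (upper-v le) refl = contradiction ([k+k]∸n≤k⇒k≤n 0 le) λ ()

  t₀≢t₁ : ∀ {j} → t₀ j ≢ t₁ j
  t₀≢t₁ eq = ≢-nonZero⁻¹ K (trans (sym (Finₚ.toℕ-fromℕ K)) (cong toℕ (sym (u-injective eq))))
    where
    u-injective : ∀ {j j' p q} → u j p ≡ u j' q → p ≡ q
    u-injective refl = refl

  UpperOccupied : VSet → Fin m → Set
  UpperOccupied I i = ∃[ x ] NearTop i x × I x ≡ true

  upperOccupied? : ∀ I i → Dec (UpperOccupied I i)
  upperOccupied? I i = map′ to from
    ((I (kc0 i) Boolₚ.≟ true) ⊎-dec ((I (kc2 i) Boolₚ.≟ true) ⊎-dec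
      Finₚ.any? (λ p → ((k + k) ∸ toℕ p ≤? k) ×-dec (I (v i p) Boolₚ.≟ true))))
    where
    to : I (kc0 i) ≡ true ⊎ I (kc2 i) ≡ true ⊎ ∃[ p ] (k + k) ∸ toℕ p ≤ k × I (v i p) ≡ true →
         UpperOccupied I i
    to (inj₁ occ)                 = kc0 i , upper-kc0 , occ
    to (inj₂ (inj₁ occ))          = kc2 i , upper-kc2 , occ
    to (inj₂ (inj₂ (p , le , occ))) = v i p , upper-v le , occ
    from : UpperOccupied I i →
           I (kc0 i) ≡ true ⊎ I (kc2 i) ≡ true ⊎ ∃[ p ] (k + k) ∸ toℕ p ≤ k × I (v i p) ≡ true
    from (_ , upper-kc0 , occ)  = inj₁ occ
    from (_ , upper-kc2 , occ)  = inj₂ (inj₁ occ)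
    from (_ , upper-v le , occ) = inj₂ (inj₂ (_ , le , occ))

  Advanced : VSet → Fin m → Set
  Advanced I i = I (bottom i) ≡ false × UpperOccupied I i

  advanced? : ∀ I i → Dec (Advanced I i)
  advanced? I i = (I (bottom i) Boolₚ.≟ false) ×-dec upperOccupied? I i

  vacancy : VSet → Vertex → ℕ
  vacancy I x = penalty (I x Boolₚ.≟ true)

  vacancy-anti : ∀ I J x → (J x ≡ true → I x ≡ true) → vacancy I x ≤ vacancy J x
  vacancy-anti I J x = penalty-anti (I x Boolₚ.≟ true) (J x Boolₚ.≟ true)

  vacancy-≤1 : ∀ I x → vacancy I x ≤ 1
  vacancy-≤1 I x = penalty-≤1 (I x Boolₚ.≟ true)

  clausePotential : VSet → Fin m → ℕ
  clausePotential I i = vacancy I (top i) + penalty (advanced? I i)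

  variablePotential : VSet → Fin n → ℕ
  variablePotential I j = vacancy I (t₀ j) + vacancy I (t₁ j)

  potential : VSet → ℕ
  potential I = sum (clausePotential I) + sum (variablePotential I)

  module _ {I J a b} (Ia : I a ≡ true) (M : Move I J a b) (d : DistLe k a b) where

    clausePotential-mono : ∀ i → owner b ≢ inj₁ i → clausePotential I i ≤ clausePotential J i
    clausePotential-mono i b∉i =
      +-mono-≤ (vacancy-anti I J (top i) (move-reflects M Ia (outside refl)))
               (penalty-anti (advanced? I i) (advanced? J i) advanced)
      where
      outside : ∀ {x} → owner x ≡ inj₁ i → x ≢ b
      outside x∈i refl = b∉i x∈i
      advanced : Advanced J i → Advanced I i
      advanced (J0 , x , x∈ , Jx) = bottom-vacant , x , x∈ , move-reflects M Ia (outside (NearTop-owner x∈)) Jx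
        where
        bottom-vacant : I (bottom i) ≡ false
        bottom-vacant with I (bottom i) in I0
        ... | false = refl
        ... | true with refl ← move-vacated M I0 J0 = contradiction (NearBottom-owner (NearBottom-of-dist d)) b∉i

    clausePotential-≤suc : ∀ i → clausePotential I i ≤ suc (clausePotential J i)
    clausePotential-≤suc i with b ≟ᵛ top i
    ... | yes refl =
      +-mono-≤ (≤-trans (vacancy-≤1 I (top i)) (s≤s z≤n)) (penalty-anti (advanced? I i) (advanced? J i) advanced)
      where
      a∈ : NearTop i a
      a∈ = NearTop-of-dist d
      advanced : Advanced J i → Advanced I i
      advanced (J0 , _) = trans (Move.elsewhere M _ (bottom∉NearTop a∈ ∘ sym) λ ()) J0 , a , a∈ , Ia
    ... | no b≢top = ≤-trans
      (+-mono-≤ (vacancy-anti I J (top i) (move-reflects M Ia (b≢top ∘ sym)))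
                (≤-trans (penalty-≤1 (advanced? I i)) (s≤s z≤n)))
      (≤-reflexive (+-suc _ _))

    variablePotential-mono : ∀ j → owner b ≢ inj₂ j → variablePotential I j ≤ variablePotential J j
    variablePotential-mono j b∉j =
      +-mono-≤ (vacancy-anti I J (t₀ j) (move-reflects M Ia (outside refl)))
               (vacancy-anti I J (t₁ j) (move-reflects M Ia (outside refl)))
      where
      outside : ∀ {x} → owner x ≡ inj₂ j → x ≢ b
      outside x∈j refl = b∉j x∈j

    variablePotential-≤suc : ∀ j → variablePotential I j ≤ suc (variablePotential J j)
    variablePotential-≤suc j with b ≟ᵛ t₀ j
    ... | yes refl =
      +-mono-≤ (≤-trans (vacancy-≤1 I (t₀ j)) (s≤s z≤n)) (vacancy-anti I J (t₁ j) (move-reflects M Ia (t₀≢t₁ ∘ sym)))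
    ... | no b≢t₀ = ≤-trans
      (+-mono-≤ (vacancy-anti I J (t₀ j) (move-reflects M Ia (b≢t₀ ∘ sym)))
                (≤-trans (vacancy-≤1 I (t₁ j)) (s≤s z≤n)))
      (≤-reflexive (+-suc _ _))

    potential-≤suc : potential I ≤ suc (potential J)
    potential-≤suc with owner b in b∈
    ... | inj₁ i = +-mono-≤
      (sum-≤-suc {f = clausePotential I} {clausePotential J} i
        (λ i' i'≢i → clausePotential-mono i' (i'≢i ∘ sym ∘ Sumₚ.inj₁-injective ∘ trans (sym b∈)))
        (clausePotential-≤suc i))
      (sum-mono-≤ (λ j → variablePotential-mono j (λ b∈j → contradiction (trans (sym b∈) b∈j) λ ())))
    ... | inj₂ j = ≤-trans (+-mono-≤
      (sum-mono-≤ (λ i → clausePotential-mono i (λ b∈i → contradiction (trans (sym b∈) b∈i) λ ())))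
      (sum-≤-suc {f = variablePotential I} {variablePotential J} j
        (λ j' j'≢j → variablePotential-mono j' (j'≢j ∘ sym ∘ Sumₚ.inj₂-injective ∘ trans (sym b∈)))
        (variablePotential-≤suc j)))
      (≤-reflexive (+-suc _ _))

  potential-target : ∀ {I} → I ≈ It → potential I ≡ 0
  potential-target {I} I≈It = cong₂ _+_
    (trans (sum-const clausePotential≡0) (*-zeroʳ m)) (trans (sum-const variablePotential≡0) (*-zeroʳ n))
    where
    It-top : ∀ {i} → It (top i) ≡ true
    It-top = dec-true (toℕ end ≟ (k + k)) toℕ-end
    It-t₁ : ∀ {j} → It (t₁ j) ≡ true
    It-t₁ = trans (cong (does (toℕ (fromℕ K) ≟ 0) ∨_) (dec-true (toℕ (fromℕ K) ≟ K) (Finₚ.toℕ-fromℕ K)))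
                  (Boolₚ.∨-zeroʳ _)
    occupied : ∀ {x} → It x ≡ true → vacancy I x ≡ 0
    occupied {x} Itx = penalty-yes _ (trans (I≈It x) Itx)
    clausePotential≡0 : ∀ i → clausePotential I i ≡ 0
    clausePotential≡0 i = cong₂ _+_ (occupied (It-top {i}))
      (penalty-yes (advanced? I i) (I≈It (bottom i) , top i , top∈NearTop , trans (I≈It (top i)) (It-top {i})))
    variablePotential≡0 : ∀ j → variablePotential I j ≡ 0
    variablePotential≡0 j = cong₂ _+_ (occupied refl) (occupied (It-t₁ {j}))

  potential-source : potential Is ≡ 2 * (m + n)
  potential-source = begin
    sum (clausePotential Is) + sum (variablePotential Is)
      ≡⟨ cong₂ _+_ (sum-const {f = clausePotential Is} (λ _ → refl))
                   (sum-const {f = variablePotential Is} (λ _ → refl)) ⟩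
    m * 2 + n * 2  ≡⟨ cong₂ _+_ (*-comm m 2) (*-comm n 2) ⟩
    2 * m + 2 * n  ≡⟨ *-distribˡ-+ 2 m n ⟨
    2 * (m + n)    ∎
    where open ≡-Reasoning

  jump-potential : ∀ {I J} → Jump I J → potential I ≤ suc (potential J)
  jump-potential (_ , _ , Ia , Ja , Jb , _ , rest , d) =
    potential-≤suc Ia (record { vacates = Ja ; fills = Jb ; elsewhere = rest }) d

  potential≤length : ∀ {ℓ I} → ReconfSeq ℓ I It → potential I ≤ ℓ
  potential≤length (done _ I≈It)    = ≤-reflexive (potential-target I≈It)
  potential≤length (next _ I↔J seq) = ≤-trans (jump-potential I↔J) (s≤s (potential≤length seq))

  data ClausePhase : Set where
    start  : ClausePhase
    atK    : Fin 3 → ClausePhase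
    finish : ClausePhase

  clauseToken : Fin m → ClausePhase → Vertex
  clauseToken i start                            = bottom i
  clauseToken i (atK Fin.zero)                   = kc0 i
  clauseToken i (atK (Fin.suc Fin.zero))         = middle i
  clauseToken i (atK (Fin.suc (Fin.suc Fin.zero))) = kc2 i
  clauseToken i finish                           = top i

  data VariablePhase : Set where
    unset        : VariablePhase
    set finished : Bool → VariablePhase

  -- In phase set σ the token of s^j_{sIdx σ}, whose neighbours are the clause vertices of the
  -- literals made true by σ, has moved to t^j_1; each transition replaces one component.
  variableTokens : Fin n → VariablePhase → Vertex × Vertex
  variableTokens j unset            = s j (sIdx true) , s j (sIdx false)
  variableTokens j (set true)       = t₁ j , s j (sIdx false)
  variableTokens j (set false)      = s j (sIdx true) , t₁ j
  variableTokens j (finished true)  = t₁ j , t₀ j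
  variableTokens j (finished false) = t₀ j , t₁ j

  data Fixes : VariablePhase → Bool → Set where
    set-fixes      : ∀ {σ} → Fixes (set σ) σ
    finished-fixes : ∀ {σ} → Fixes (finished σ) σ

  LiteralFixed : (Fin n → VariablePhase) → Literal n → Set
  LiteralFixed vp ℓ = Fixes (vp (proj₁ ℓ)) (proj₂ ℓ)

  _∈₂_ : Vertex → Vertex × Vertex → Bool
  x ∈₂ p = does (x ≟ᵛ proj₁ p) ∨ does (x ≟ᵛ proj₂ p)

  occupied : (Fin m → ClausePhase) → (Fin n → VariablePhase) → VSet
  occupied cp vp x =
    [ (λ i → does (x ≟ᵛ clauseToken i (cp i))) , (λ j → x ∈₂ variableTokens j (vp j)) ]′ (owner x)

  module _ (cp : Fin m → ClausePhase) (vp : Fin n → VariablePhase) {x : Vertex} where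

    private
      by-owner : Fin m ⊎ Fin n → Bool
      by-owner = [ (λ i → does (x ≟ᵛ clauseToken i (cp i))) , (λ j → x ∈₂ variableTokens j (vp j)) ]′

    occupied-clause : ∀ {i} → owner x ≡ inj₁ i → occupied cp vp x ≡ does (x ≟ᵛ clauseToken i (cp i))
    occupied-clause = cong by-owner

    occupied-variable : ∀ {j} → owner x ≡ inj₂ j → occupied cp vp x ≡ x ∈₂ variableTokens j (vp j)
    occupied-variable = cong by-owner

  owner-clauseToken : ∀ i ph → owner (clauseToken i ph) ≡ inj₁ i
  owner-clauseToken i start                              = refl
  owner-clauseToken i (atK Fin.zero)                     = refl
  owner-clauseToken i (atK (Fin.suc Fin.zero))           = refl
  owner-clauseToken i (atK (Fin.suc (Fin.suc Fin.zero))) = refl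
  owner-clauseToken i finish                             = refl

  clause-move : ∀ cp vp i ph → clauseToken i (cp i) ≢ clauseToken i ph →
                Move (occupied cp vp) (occupied (updateAt cp i (const ph)) vp)
                     (clauseToken i (cp i)) (clauseToken i ph)
  clause-move cp vp i ph a≢b = record
    { vacates   = trans (occupied-clause cp' vp (owner-clauseToken i (cp i)))
                        (trans (at-i _) (dec-false (_ ≟ᵛ _) a≢b))
    ; fills     = trans (occupied-clause cp' vp (owner-clauseToken i ph)) (trans (at-i _) (dec-true (_ ≟ᵛ _) refl))
    ; elsewhere = elsewhere
    }
    where
    cp' = updateAt cp i (const ph)
    at-i : ∀ x → does (x ≟ᵛ clauseToken i (cp' i)) ≡ does (x ≟ᵛ clauseToken i ph)
    at-i x = cong (λ ph' → does (x ≟ᵛ clauseToken i ph')) (updateAt-updates i cp)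
    elsewhere : ∀ x → x ≢ clauseToken i (cp i) → x ≢ clauseToken i ph → occupied cp vp x ≡ occupied cp' vp x
    elsewhere x x≢a x≢b with owner x
    ... | inj₂ _ = refl
    ... | inj₁ i' with i' Fin.≟ i
    ...   | yes refl = trans (dec-false (x ≟ᵛ _) x≢a) (sym (trans (at-i x) (dec-false (x ≟ᵛ _) x≢b)))
    ...   | no i'≢i  = cong (λ ph' → does (x ≟ᵛ clauseToken i' ph')) (sym (updateAt-minimal i' i cp i'≢i))

  data Replaces : Vertex × Vertex → Vertex × Vertex → Vertex → Vertex → Set where
    first  : ∀ {a b c} → a ≢ b → a ≢ c → Replaces (a , c) (b , c) a b
    second : ∀ {a b c} → a ≢ b → a ≢ c → Replaces (c , a) (c , b) a b

  ∈₂-replaces : ∀ {p q a b} → Replaces p q a b →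
                a ∈₂ q ≡ false × b ∈₂ q ≡ true × (∀ x → x ≢ a → x ≢ b → x ∈₂ p ≡ x ∈₂ q)
  ∈₂-replaces {a = a} {b} (first {c = c} a≢b a≢c) =
    cong₂ _∨_ (dec-false (a ≟ᵛ b) a≢b) (dec-false (a ≟ᵛ c) a≢c) ,
    cong (_∨ does (b ≟ᵛ c)) (dec-true (b ≟ᵛ b) refl) ,
    λ x x≢a x≢b → cong (_∨ does (x ≟ᵛ c)) (trans (dec-false (x ≟ᵛ a) x≢a) (sym (dec-false (x ≟ᵛ b) x≢b)))
  ∈₂-replaces {a = a} {b} (second {c = c} a≢b a≢c) =
    cong₂ _∨_ (dec-false (a ≟ᵛ c) a≢c) (dec-false (a ≟ᵛ b) a≢b) ,
    trans (cong (does (b ≟ᵛ c) ∨_) (dec-true (b ≟ᵛ b) refl)) (Boolₚ.∨-zeroʳ _) ,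
    λ x x≢a x≢b → cong (does (x ≟ᵛ c) ∨_) (trans (dec-false (x ≟ᵛ a) x≢a) (sym (dec-false (x ≟ᵛ b) x≢b)))

  variable-move : ∀ cp vp j ph {a b} → Replaces (variableTokens j (vp j)) (variableTokens j ph) a b →
                  owner a ≡ inj₂ j → owner b ≡ inj₂ j →
                  Move (occupied cp vp) (occupied cp (updateAt vp j (const ph))) a b
  variable-move cp vp j ph {a} {b} rep a∈j b∈j = record
    { vacates   = trans (occupied-variable cp vp' a∈j) (trans (at-j a) (proj₁ (∈₂-replaces rep)))
    ; fills     = trans (occupied-variable cp vp' b∈j) (trans (at-j b) (proj₁ (proj₂ (∈₂-replaces rep))))
    ; elsewhere = elsewhere
    }
    where
    vp' = updateAt vp j (const ph)
    at-j : ∀ x → x ∈₂ variableTokens j (vp' j) ≡ x ∈₂ variableTokens j ph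
    at-j x = cong (λ ph' → x ∈₂ variableTokens j ph') (updateAt-updates j vp)
    elsewhere : ∀ x → x ≢ a → x ≢ b → occupied cp vp x ≡ occupied cp vp' x
    elsewhere x x≢a x≢b with owner x
    ... | inj₁ _ = refl
    ... | inj₂ j' with j' Fin.≟ j
    ...   | yes refl = trans (proj₂ (proj₂ (∈₂-replaces rep)) x x≢a x≢b) (sym (at-j x))
    ...   | no j'≢j  = cong (λ ph' → x ∈₂ variableTokens j' ph') (sym (updateAt-minimal j' j vp j'≢j))

  owner-variableTokens : ∀ j ph → owner (proj₁ (variableTokens j ph)) ≡ inj₂ j ×
                                  owner (proj₂ (variableTokens j ph)) ≡ inj₂ j
  owner-variableTokens j unset            = refl , refl
  owner-variableTokens j (set true)       = refl , refl
  owner-variableTokens j (set false)      = refl , refl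
  owner-variableTokens j (finished true)  = refl , refl
  owner-variableTokens j (finished false) = refl , refl

  record Canonical (I : VSet) : Set where
    field
      clausePhase   : Fin m → ClausePhase
      variablePhase : Fin n → VariablePhase
      occupancy     : I ≈ occupied clausePhase variablePhase
      witness       : ∀ i → clausePhase i ≢ start → ∃[ r ] LiteralFixed variablePhase (Φ i r)

  module _ {I J : VSet} (C : Canonical I) where
    open Canonical C

    advance-clause : ∀ i ph {a b} → a ≡ clauseToken i (clausePhase i) → b ≡ clauseToken i ph → a ≢ b →
                     ∃[ r ] LiteralFixed variablePhase (Φ i r) → Move I J a b → Canonical J
    advance-clause i ph refl refl a≢b fixed M = record
      { clausePhase   = updateAt clausePhase i (const ph)
      ; variablePhase = variablePhase
      ; occupancy     = move-unique M occupancy (clause-move clausePhase variablePhase i ph a≢b)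
      ; witness       = witness′
      }
      where
      witness′ : ∀ i' → updateAt clausePhase i (const ph) i' ≢ start →
                 ∃[ r ] LiteralFixed variablePhase (Φ i' r)
      witness′ i' started with i' Fin.≟ i
      ... | yes refl = fixed
      ... | no i'≢i  = witness i' (started ∘ trans (updateAt-minimal i' i clausePhase i'≢i))

    advance-variable : ∀ j {ph₀} ph {a b} → variablePhase j ≡ ph₀ →
                       Replaces (variableTokens j ph₀) (variableTokens j ph) a b →
                       owner a ≡ inj₂ j → owner b ≡ inj₂ j →
                       (∀ {σ} → Fixes ph₀ σ → Fixes ph σ) →
                       Move I J a b → Canonical J
    advance-variable j ph refl rep a∈j b∈j keeps M = record
      { clausePhase   = clausePhase
      ; variablePhase = vp'
      ; occupancy     = move-unique M occupancy (variable-move clausePhase variablePhase j ph rep a∈j b∈j)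
      ; witness       = witness′
      }
      where
      vp' = updateAt variablePhase j (const ph)
      still-fixed : ∀ j' {σ} → Fixes (variablePhase j') σ → Fixes (vp' j') σ
      still-fixed j' fixed with j' Fin.≟ j
      ... | yes refl = subst (λ ph' → Fixes ph' _) (sym (updateAt-updates j variablePhase)) (keeps fixed)
      ... | no j'≢j  = subst (λ ph' → Fixes ph' _) (sym (updateAt-minimal j' j variablePhase j'≢j)) fixed
      witness′ : ∀ i → clausePhase i ≢ start → ∃[ r ] LiteralFixed vp' (Φ i r)
      witness′ i started with witness i started
      ... | r , fixed = r , still-fixed _ fixed

    variable-set : ∀ j σ → variablePhase j ≡ unset → Move I J (s j (sIdx σ)) (t₁ j) → Canonical J
    variable-set j true  is-unset = advance-variable j (set true)  is-unset (first (λ ()) (λ ()))  refl refl λ ()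
    variable-set j false is-unset = advance-variable j (set false) is-unset (second (λ ()) (λ ())) refl refl λ ()

    variable-finish : ∀ j σ → variablePhase j ≡ set σ → Move I J (s j (sIdx (not σ))) (t₀ j) → Canonical J
    variable-finish j true  setσ =
      advance-variable j (finished true) setσ (second (λ ()) (λ ())) refl refl λ { set-fixes → finished-fixes }
    variable-finish j false setσ =
      advance-variable j (finished false) setσ (first (λ ()) (λ ())) refl refl λ { set-fixes → finished-fixes }

  middle∈NearTop : ∀ {i} → NearTop i (middle i)
  middle∈NearTop = upper-v (≤-reflexive (trans (cong ((k + k) ∸_) toℕ-mid) [k+k]∸k≡k))

  clauseToken-upper : ∀ {i} ph → ph ≢ start → NearTop i (clauseToken i ph)
  clauseToken-upper start                              started = contradiction refl started
  clauseToken-upper (atK Fin.zero)                     _       = upper-kc0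
  clauseToken-upper (atK (Fin.suc Fin.zero))           _       = middle∈NearTop
  clauseToken-upper (atK (Fin.suc (Fin.suc Fin.zero))) _       = upper-kc2
  clauseToken-upper finish                             _       = top∈NearTop

  InK⇒NearTop : ∀ {x} → InK x → ∃[ i ] NearTop i x
  InK⇒NearTop (inK0 i)        = i , upper-kc0
  InK⇒NearTop (inK1 i p p≡k)  = i , upper-v (≤-reflexive (trans (cong ((k + k) ∸_) p≡k) [k+k]∸k≡k))
  InK⇒NearTop (inK2 i)        = i , upper-kc2

  top∉K : ∀ {i x} → InK x → x ≢ top i
  top∉K (inK1 _ _ p≡k) refl = contradiction (trans (sym toℕ-end) p≡k) (m+1+n≢m k)

  IsKr⇒clauseToken : ∀ {i r x} → IsKr i r x → x ≡ clauseToken i (atK r)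
  IsKr⇒clauseToken (isK0 i)       = refl
  IsKr⇒clauseToken (isK1 i p p≡k) = cong (v i) (Finₚ.toℕ-injective (trans p≡k (sym toℕ-mid)))
  IsKr⇒clauseToken (isK2 i)       = refl

  sIdx-surjective : ∀ c → ∃[ σ ] sIdx σ ≡ c
  sIdx-surjective Fin.zero            = true , refl
  sIdx-surjective (Fin.suc Fin.zero)  = false , refl

  value : VariablePhase → Bool
  value unset        = true  -- arbitrary: no witness literal uses an unset variable
  value (set σ)      = σ
  value (finished σ) = σ

  litVal-fixed : ∀ vp ℓ → LiteralFixed vp ℓ → litVal (value ∘ vp) ℓ ≡ true
  litVal-fixed vp (x , true)  fixed with vp x | fixed
  ... | set _      | set-fixes      = refl
  ... | finished _ | finished-fixes = refl
  litVal-fixed vp (x , false) fixed with vp x | fixed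
  ... | set _      | set-fixes      = refl
  ... | finished _ | finished-fixes = refl

  module _ {I} (C : Canonical I) where
    open Canonical C

    clause-occupant : ∀ {x i} → owner x ≡ inj₁ i → I x ≡ true → x ≡ clauseToken i (clausePhase i)
    clause-occupant {x} x∈i Ix = dec-true⁻¹ (x ≟ᵛ _)
      (trans (sym (occupied-clause clausePhase variablePhase x∈i)) (trans (sym (occupancy x)) Ix))

    clause-single-token : ∀ {x y i} → owner x ≡ inj₁ i → owner y ≡ inj₁ i → I x ≡ true → I y ≡ true → x ≡ y
    clause-single-token x∈i y∈i Ix Iy = trans (clause-occupant x∈i Ix) (sym (clause-occupant y∈i Iy))

    clauseToken-occupied : ∀ i → I (clauseToken i (clausePhase i)) ≡ true
    clauseToken-occupied i = trans (occupancy _)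
      (trans (occupied-clause clausePhase variablePhase (owner-clauseToken i _)) (dec-true (_ ≟ᵛ _) refl))

    bottom-vacant⇒started : ∀ {i} → I (bottom i) ≡ false → clausePhase i ≢ start
    bottom-vacant⇒started {i} I0 atStart =
      contradiction (trans (sym (subst (λ ph → I (clauseToken i ph) ≡ true) atStart (clauseToken-occupied i))) I0)
                    λ ()

    bottom-vacant⇒upper : ∀ {i} → I (bottom i) ≡ false → UpperOccupied I i
    bottom-vacant⇒upper {i} I0 =
      _ , clauseToken-upper (clausePhase i) (bottom-vacant⇒started I0) , clauseToken-occupied i

    variableTokens-occupied : ∀ j → I (proj₁ (variableTokens j (variablePhase j))) ≡ true ×
                                    I (proj₂ (variableTokens j (variablePhase j))) ≡ true
    variableTokens-occupied j =
      trans (occupancy x) (trans (occupied-variable clausePhase variablePhase x∈j)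
                                 (cong (_∨ does (x ≟ᵛ y)) (dec-true (x ≟ᵛ x) refl))) ,
      trans (occupancy y) (trans (occupied-variable clausePhase variablePhase y∈j)
                                 (trans (cong (does (y ≟ᵛ x) ∨_) (dec-true (y ≟ᵛ y) refl)) (Boolₚ.∨-zeroʳ _)))
      where
      x = proj₁ (variableTokens j (variablePhase j))
      y = proj₂ (variableTokens j (variablePhase j))
      x∈j = proj₁ (owner-variableTokens j (variablePhase j))
      y∈j = proj₂ (owner-variableTokens j (variablePhase j))

    t₁-vacant⇒unset : ∀ {j} → I (t₁ j) ≡ false → variablePhase j ≡ unset
    t₁-vacant⇒unset {j} vacant with variablePhase j | variableTokens-occupied j
    ... | unset          | _       = refl
    ... | set true       | o₁ , _  = contradiction (trans (sym o₁) vacant) λ ()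
    ... | set false      | _  , o₂ = contradiction (trans (sym o₂) vacant) λ ()
    ... | finished true  | o₁ , _  = contradiction (trans (sym o₁) vacant) λ ()
    ... | finished false | _  , o₂ = contradiction (trans (sym o₂) vacant) λ ()

    unset-path-vacant : ∀ {j} → variablePhase j ≡ unset → ∀ q → I (u j q) ≡ false
    unset-path-vacant {j} is-unset q = trans (occupancy _)
      (trans (occupied-variable clausePhase variablePhase refl)
             (trans (cong (λ ph → u j q ∈₂ variableTokens j ph) is-unset)
                    (cong₂ _∨_ (dec-false (u j q ≟ᵛ _) λ ()) (dec-false (u j q ≟ᵛ _) λ ()))))

    fixed-if-vacant : ∀ j σ → I (s j (sIdx σ)) ≡ false → I (t₀ j) ≡ false → Fixes (variablePhase j) σ
    fixed-if-vacant j σ s-vacant t₀-vacant with variablePhase j | variableTokens-occupied j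
    fixed-if-vacant j true  s-vacant _ | unset | o₁ , _ = contradiction (trans (sym o₁) s-vacant) λ ()
    fixed-if-vacant j false s-vacant _ | unset | _ , o₂ = contradiction (trans (sym o₂) s-vacant) λ ()
    fixed-if-vacant j true  _ _        | set true  | _ = set-fixes
    fixed-if-vacant j false s-vacant _ | set true  | _ , o₂ = contradiction (trans (sym o₂) s-vacant) λ ()
    fixed-if-vacant j true  s-vacant _ | set false | o₁ , _ = contradiction (trans (sym o₁) s-vacant) λ ()
    fixed-if-vacant j false _ _        | set false | _ = set-fixes
    fixed-if-vacant j σ _ t₀-vacant | finished true  | _ , o₂ = contradiction (trans (sym o₂) t₀-vacant) λ ()
    fixed-if-vacant j σ _ t₀-vacant | finished false | o₁ , _ = contradiction (trans (sym o₁) t₀-vacant) λ ()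

  data Target : Vertex → Set where
    target-top : ∀ {i} → Target (top i)
    target-t₀  : ∀ {j} → Target (t₀ j)
    target-t₁  : ∀ {j} → Target (t₁ j)

  target? : ∀ x → Dec (Target x)
  target? (v i p) with p Fin.≟ end
  ... | yes refl  = yes target-top
  ... | no p≢end  = no λ { target-top → p≢end refl }
  target? (u j p) with p Fin.≟ Fin.zero | p Fin.≟ fromℕ K
  ... | yes refl | _        = yes target-t₀
  ... | no _     | yes refl = yes target-t₁
  ... | no p≢0   | no p≢K   = no λ { target-t₀ → p≢0 refl ; target-t₁ → p≢K refl }
  target? (kc0 _) = no λ ()
  target? (kc2 _) = no λ ()
  target? (s _ _) = no λ ()

  bottom? : ∀ x → Dec (∃[ i ] x ≡ bottom i)
  bottom? (v i p) with p Fin.≟ Fin.zero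
  ... | yes refl = yes (i , refl)
  ... | no p≢0   = no λ { (_ , refl) → p≢0 refl }
  bottom? (kc0 _) = no λ { (_ , ()) }
  bottom? (kc2 _) = no λ { (_ , ()) }
  bottom? (u _ _) = no λ { (_ , ()) }
  bottom? (s _ _) = no λ { (_ , ()) }

  module _ {I J} (C : Canonical I) (J-independent : Independent J) where
    open Canonical C

    adjacent-vacant : ∀ {a b x} → Move I J a b → x ≢ a → Adj x b → I x ≡ false
    adjacent-vacant {x = x} M x≢a adj with I x in Ix
    ... | false = refl
    ... | true  = contradiction adj (J-independent _ _ (move-preserves M x≢a Ix) (Move.fills M))

    jump-to-top : ∀ {a i} → I a ≡ true → I (top i) ≡ false → Move I J a (top i) → DistLe k a (top i) →
                  Canonical J
    jump-to-top {a} {i} Ia Ib M d =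
      advance-clause C i finish a≡token refl (occupied≢vacant {I} Ia Ib) (witness i started) M
      where
      a∈ : NearTop i a
      a∈ = NearTop-of-dist d
      a≡token : a ≡ clauseToken i (clausePhase i)
      a≡token = clause-occupant C (NearTop-owner a∈) Ia
      started : clausePhase i ≢ start
      started atStart = bottom∉NearTop a∈ (trans a≡token (cong (clauseToken i) atStart))

    jump-from-bottom : ∀ {i r b} → I (bottom i) ≡ true → I b ≡ false → IsKr i r b → Move I J (bottom i) b →
                       Canonical J
    jump-from-bottom {i} {r} {b} I0 Ib isK M =
      advance-clause C i (atK r) (clause-occupant C refl I0) (IsKr⇒clauseToken isK) (occupied≢vacant {I} I0 Ib)
        (r , fixed-if-vacant C (proj₁ (Φ i r)) (proj₂ (Φ i r))
               (adjacent-vacant M (λ ()) (inj₁ (lit-s i r b isK)))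
               (adjacent-vacant M (λ ()) (inj₁ (lit-t i r b Fin.zero isK refl))))
        M

    s-occupant-leaves : ∀ {a j c} → Move I J a (t₀ j) → I (s j c) ≡ true → s j c ≡ a
    s-occupant-leaves {a} {j} {c} M Isc with s j c ≟ᵛ a
    ... | yes s≡a = s≡a
    ... | no s≢a  = contradiction (trans (sym Isc) (adjacent-vacant M s≢a (inj₁ (s-t0 j c Fin.zero refl)))) λ ()

    jump-to-t₀ : ∀ {a j} → I a ≡ true → I (t₀ j) ≡ false → Move I J a (t₀ j) → Canonical J
    jump-to-t₀ {a} {j} Ia Ib M with variablePhase j in phase | variableTokens-occupied C j
    ... | unset          | o₁ , o₂ =
      contradiction (trans (s-occupant-leaves M o₁) (sym (s-occupant-leaves M o₂))) λ ()
    ... | set true       | _  , o₂ with refl ← s-occupant-leaves M o₂ = variable-finish C j true phase M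
    ... | set false      | o₁ , _  with refl ← s-occupant-leaves M o₁ = variable-finish C j false phase M
    ... | finished true  | _  , o₂ = contradiction (trans (sym o₂) Ib) λ ()
    ... | finished false | o₁ , _  = contradiction (trans (sym o₁) Ib) λ ()

    module _ {a b} (Ia : I a ≡ true) (M : Move I J a b) (d : DistLe k a b) where

      K-token-leaving-clause : ∀ {i} → InK a → NearTop i a → owner b ≢ inj₁ i →
                               clausePotential I i < clausePotential J i
      K-token-leaving-clause {i} a∈K a∈ b∉i = begin-strict
        vacancy I (top i) + penalty (advanced? I i) ≡⟨ cong (vacancy I (top i) +_) (penalty-yes (advanced? I i) advanced) ⟩
        vacancy I (top i) + 0                       ≤⟨ +-monoˡ-≤ 0 (vacancy-≤1 I (top i)) ⟩
        1                                           <⟨ ≤-refl ⟩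
        2                                           ≡⟨ cong₂ _+_ (penalty-no (J (top i) Boolₚ.≟ true) top-vacant)
                                                                 (penalty-no (advanced? J i) not-advanced) ⟨
        clausePotential J i                         ∎
        where
        open ≤-Reasoning
        a∈i = NearTop-owner a∈
        outside : ∀ {x} → owner x ≡ inj₁ i → x ≢ b
        outside x∈i refl = b∉i x∈i
        only-a : ∀ {x} → owner x ≡ inj₁ i → J x ≡ true → x ≡ a
        only-a x∈i Jx = clause-single-token C x∈i a∈i (move-reflects M Ia (outside x∈i) Jx) Ia
        advanced : Advanced I i
        advanced = bottom-vacant , a , a∈ , Ia
          where
          bottom-vacant : I (bottom i) ≡ false
          bottom-vacant with I (bottom i) in I0
          ... | false = refl
          ... | true  = contradiction (clause-single-token C refl a∈i I0 Ia) (bottom∉NearTop a∈ ∘ sym)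
        top-vacant : J (top i) ≢ true
        top-vacant Jtop = top∉K a∈K (sym (only-a refl Jtop))
        not-advanced : ¬ Advanced J i
        not-advanced (_ , x , x∈ , Jx) =
          contradiction (trans (sym Jx) (trans (cong J (only-a (NearTop-owner x∈) Jx)) (Move.vacates M))) λ ()

      jump-K-to-t₁ : ∀ {j} → b ≡ t₁ j → InK a → potential I ≤ potential J
      jump-K-to-t₁ {j} refl a∈K = begin
        sum (clausePotential I) + sum (variablePotential I)
          ≤⟨ +-monoʳ-≤ (sum (clausePotential I)) (sum-≤-suc {f = variablePotential I} {variablePotential J} j
                (λ j' j'≢j → variablePotential-mono Ia M d j' (j'≢j ∘ sym ∘ Sumₚ.inj₂-injective))
                (variablePotential-≤suc Ia M d j)) ⟩
        sum (clausePotential I) + suc (sum (variablePotential J))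
          ≡⟨ +-suc _ _ ⟩
        suc (sum (clausePotential I)) + sum (variablePotential J)
          ≤⟨ +-monoˡ-≤ _ (sum-mono-< (proj₁ (InK⇒NearTop a∈K)) (λ i → clausePotential-mono Ia M d i λ ())
                            (K-token-leaving-clause a∈K (proj₂ (InK⇒NearTop a∈K)) λ ())) ⟩
        sum (clausePotential J) + sum (variablePotential J) ∎
        where open ≤-Reasoning

      jump-to-t₁ : ∀ {j} → b ≡ t₁ j → I b ≡ false → Canonical J ⊎ potential I ≤ potential J
      jump-to-t₁ {j} refl Ib with NearT₁-of-dist d
      ... | near-u {q}   = contradiction (trans (sym Ia) (unset-path-vacant C (t₁-vacant⇒unset C Ib) q)) λ ()
      ... | near-s {c} with σ , refl ← sIdx-surjective c = inj₁ (variable-set C j σ (t₁-vacant⇒unset C Ib) M)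
      ... | near-K a∈K   = inj₂ (jump-K-to-t₁ refl a∈K)

      jump-elsewhere : ¬ Target b → (∀ i → a ≡ bottom i → ¬ NearTop i b) → potential I ≤ potential J
      jump-elsewhere b∉T b∉upper = +-mono-≤ (sum-mono-≤ clause-mono) (sum-mono-≤ variable-mono)
        where
        target≢b : ∀ {x} → Target x → x ≢ b
        target≢b x∈T refl = b∉T x∈T
        clause-mono : ∀ i → clausePotential I i ≤ clausePotential J i
        clause-mono i = +-mono-≤ (vacancy-anti I J (top i) (move-reflects M Ia (target≢b target-top)))
                                 (penalty-anti (advanced? I i) (advanced? J i) advanced)
          where
          advanced : Advanced J i → Advanced I i
          advanced (J0 , x , x∈ , Jx) with I (bottom i) in I0
          ... | false = refl , bottom-vacant⇒upper C I0
          ... | true  = contradiction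
                          (clause-single-token C (NearTop-owner x∈) refl (move-reflects M Ia x≢b Jx) I0)
                          (bottom∉NearTop x∈)
            where
            x≢b : x ≢ b
            x≢b refl = b∉upper i (sym (move-vacated M I0 J0)) x∈
        variable-mono : ∀ j → variablePotential I j ≤ variablePotential J j
        variable-mono j = +-mono-≤ (vacancy-anti I J (t₀ j) (move-reflects M Ia (target≢b target-t₀)))
                                   (vacancy-anti I J (t₁ j) (move-reflects M Ia (target≢b target-t₁)))

  canonical-move : ∀ {I J a b} → Canonical I → Independent J → I a ≡ true → I b ≡ false →
                   Move I J a b → DistLe k a b → Canonical J ⊎ potential I ≤ potential J
  canonical-move {a = a} {b} C J-independent Ia Ib M d with target? b
  ... | yes target-top = inj₁ (jump-to-top C J-independent Ia Ib M d)
  ... | yes target-t₀  = inj₁ (jump-to-t₀ C J-independent Ia Ib M)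
  ... | yes target-t₁  = jump-to-t₁ C J-independent Ia M d refl Ib
  ... | no b∉T with bottom? a
  ...   | no a∉bottom = inj₂ (jump-elsewhere C J-independent Ia M d b∉T λ i a≡ → contradiction (i , a≡) a∉bottom)
  ...   | yes (i , refl) with NearBottom-of-dist d
  ...     | lower-kc0 = inj₁ (jump-from-bottom C J-independent Ia Ib (isK0 i) M)
  ...     | lower-kc2 = inj₁ (jump-from-bottom C J-independent Ia Ib (isK2 i) M)
  ...     | lower-v {p} p≤k with toℕ p ≟ k
  ...       | yes p≡k = inj₁ (jump-from-bottom C J-independent Ia Ib (isK1 i p p≡k) M)
  ...       | no p≢k  = inj₂ (jump-elsewhere C J-independent Ia M d b∉T
                          λ { _ refl (upper-v le) → p≢k (≤-antisym p≤k ([k+k]∸n≤k⇒k≤n (toℕ p) le)) })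

  canonical-jump : ∀ {I J} → Canonical I → Jump I J → Independent J → Canonical J ⊎ potential I ≤ potential J
  canonical-jump C (_ , _ , Ia , Ja , Jb , Ib , rest , d) J-independent =
    canonical-move C J-independent Ia Ib (record { vacates = Ja ; fills = Jb ; elsewhere = rest }) d

  canonical-source : Canonical Is
  canonical-source = record
    { clausePhase   = const start
    ; variablePhase = const unset
    ; occupancy     = occupancy
    ; witness       = λ _ started → contradiction refl started
    }
    where
    occupancy : Is ≈ occupied (const start) (const unset)
    occupancy (v i Fin.zero)        = sym (dec-true (_ ≟ᵛ _) refl)
    occupancy (v i (Fin.suc p))     = sym (dec-false (_ ≟ᵛ _) λ ())
    occupancy (kc0 i)               = sym (dec-false (_ ≟ᵛ _) λ ())
    occupancy (kc2 i)               = sym (dec-false (_ ≟ᵛ _) λ ())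
    occupancy (u j p)               = sym (cong₂ _∨_ (dec-false (_ ≟ᵛ _) λ ()) (dec-false (_ ≟ᵛ _) λ ()))
    occupancy (s j Fin.zero)        =
      sym (cong (_∨ does (s j Fin.zero ≟ᵛ s j (sIdx false))) (dec-true (_ ≟ᵛ _) refl))
    occupancy (s j (Fin.suc Fin.zero)) = sym (cong₂ _∨_ (dec-false (_ ≟ᵛ _) λ ()) (dec-true (_ ≟ᵛ _) refl))

  satisfiable-at-target : ∀ {I} → Canonical I → I ≈ It → Satisfiable Φ
  satisfiable-at-target {I} C I≈It = value ∘ variablePhase , satisfied
    where
    open Canonical C
    satisfied : ∀ i → ∃[ r ] litVal (value ∘ variablePhase) (Φ i r) ≡ true
    satisfied i with witness i (bottom-vacant⇒started C (I≈It (bottom i)))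
    ... | r , fixed = r , litVal-fixed variablePhase (Φ i r) fixed

  independent : ∀ {ℓ I J} → ReconfSeq ℓ I J → Independent I
  independent (done I-independent _)   = I-independent
  independent (next I-independent _ _) = I-independent

  satisfiable-of-sequence : ∀ {ℓ I} → Canonical I → ℓ ≤ potential I → ReconfSeq ℓ I It → Satisfiable Φ
  satisfiable-of-sequence C _ (done _ I≈It) = satisfiable-at-target C I≈It
  satisfiable-of-sequence C ℓ<pot (next _ I↔J seq) with canonical-jump C I↔J (independent seq)
  ... | inj₁ C′  = satisfiable-of-sequence C′ (≤-pred (≤-trans ℓ<pot (jump-potential I↔J))) seq
  ... | inj₂ pot≤ = contradiction (≤-trans ℓ<pot (≤-trans pot≤ (potential≤length seq))) 1+n≰n

lemma12 : (k : ℕ) → 3 ≤ k → (m n : ℕ) → (Φ : Formula m n) →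
    Σ ℕ (λ ℓ → (ℓ ≤ 2 * (m + n)) ×
      Construction.ReconfSeq k m n Φ ℓ (Construction.Is k m n Φ) (Construction.It k m n Φ)) →
    Satisfiable Φ
lemma12 (suc (suc (suc k))) (s≤s (s≤s (s≤s z≤n))) m n Φ (ℓ , ℓ≤2[m+n] , seq) =
  satisfiable-of-sequence canonical-source (≤-trans ℓ≤2[m+n] (≤-reflexive (sym potential-source))) seq
  where open Reduction (suc (suc k)) Φ
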